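{- Let $\mathbb{F}$ be an infinite field of characteristic $0$ and $n$ a positive integer. None of the following is an $\vec{e}$-Ramsey algebra for any nonconstant $\vec{e}\in\Omega_0$: - $(\mathcal{M}_n(\mathbb{F}),\mathbb{F},+,\times,|\ast|)$; - $(\mathcal{M}_n(\mathbb{F}),\mathbb{F},+,\times,+_\mathbb{F},|\ast|)$; - $(\mathcal{M}_n(\mathbb{F}),\mathbb{F},+,\times,\times_\mathbb{F},|\ast|)$; - the full matrix algebra $(\mathcal{M}_n(\mathbb{F}),\mathbb{F},+,\times,+_\mathbb{F},\times_\mathbb{F},|\ast|)$.
   Context: An algebra is a pair $(\{A_\xi\}_{\xi\in I},\mathcal{F})$ with nonempty, pairwise disjoint phyla and a family $\mathcal{F}$ of operations, each with domain a finite product of phyla and codomain a phylum. A sort is $\vec{e}\in{}^\omega I$, and $\vec{b}$ is $\vec{e}$-sorted if $\vec{b}(i)\in A_{\vec{e}(i)}$ for all $i$. Orderly terms: $\mathcal{F}_0=\mathcal{F}\cup\{\mathrm{id}_{A_\xi}\}$. $\mathcal{F}_{k+1}$ is $\mathcal{F}_k$ plus all $f$ with $f(\vec{x})=g(h_1(\vec{x}_1),\dots,h_N(\vec{x}_N))$, where $g\in\mathcal{F}$ is $N$-ary, $h_i\in\mathcal{F}_k$, and $\vec{x}_1\ast\cdots\ast\vec{x}_N=\vec{x}$ is the argument list of $f$ (concatenation). $\mathrm{OT}(\mathcal{F})=\bigcup_k\mathcal{F}_k$. $\vec{a}\le_\mathcal{F}\vec{b}$ means: for each $j$ there are a finite subsequence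 $\vec{b}_j$ of $\vec{b}$ and $f_j\in\mathrm{OT}(\mathcal{F})$ with $\vec{a}(j)=f_j(\vec{b}_j)$, and $\vec{b}_0\ast\vec{b}_1\ast\cdots$ is a subsequence of $\vec{b}$. $\mathrm{FR}^{\vec{e}}_\mathcal{F}(\vec{b})=\{\vec{a}(0):\vec{a}\le_\mathcal{F}\vec{b},\ \vec{a}\ \vec{e}\text{ -sorted}\}$. $\vec{e}$-Ramsey algebra: for every $\vec{e}$-sorted $\vec{b}$ and $X\subseteq A_{\vec{e}(0)}$ some $\vec{e}$-sorted $\vec{a}\le_\mathcal{F}\vec{b}$ has $\mathrm{FR}^{\vec{e}}_\mathcal{F}(\vec{a})\subseteq X$ or disjoint from $X$. $\Omega$ is the set of sorts each of whose values is taken infinitely often, and $\Omega_0=\{\vec{e}\in\Omega:\vec{e}(0)=0\}$. The full matrix algebra has phylum $A_0=\mathbb{F}$ (index $0$) and phylum $A_1=\mathcal{M}_n(\mathbb{F})$ of $n\times n$ matrices (index $1$), regarded as disjoint. Its operations are matrix addition $+$, matrix multiplication $\times$, field operations $+_\mathbb{F},\times_\mathbb{F}$, and the determinant $|\ast|$. $(\mathcal{M}_n(\mathbb{F}),\mathbb{F},\text{ops})$ is the reduct with both phyla and only the listed operations. -}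

module Defs where

open import Level using (0ℓ)
open import Data.Nat using (ℕ; zero; suc; _<_; _≤_)
open import Data.Fin using (Fin; zero; suc)
open import Data.Product using (Σ; Σ-syntax; ∃; ∃-syntax; _×_; _,_; proj₁; proj₂)
open import Data.Sum using (_⊎_)
open import Data.List using (List; []; _∷_; _++_; map)
open import Data.List.Relation.Unary.All using (All; []; _∷_)
open import Data.List.Relation.Unary.Linked using (Linked)
open import Data.List.Membership.Propositional using (_∈_; _∉_)
import Data.Fin
import Data.Vec
open import Data.Vec using (Vec; []; _∷_; tabulate; lookup; removeAt; foldr′; zipWith)
open import Relation.Binary.PropositionalEquality using (_≡_; _≢_)
open import Relation.Nullary using (¬_)
open import Algebra.Structures using (IsCommutativeRing)

record Field : Set₁ where
  infixl 7 _*_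
  infixl 6 _+_
  field
    Carrier : Set
    _+_ _*_ : Carrier → Carrier → Carrier
    -_      : Carrier → Carrier
    0# 1#   : Carrier
    isCommutativeRing : IsCommutativeRing _≡_ _+_ _*_ -_ 0# 1#
    0≢1     : 0# ≢ 1#
    inverse : ∀ x → x ≢ 0# → ∃[ y ] (x * y ≡ 1#)

  _·1 : ℕ → Carrier
  zero ·1  = 0#
  suc n ·1 = 1# + (n ·1)

CharZero : Field → Set
CharZero F = ∀ n → Field._·1 F (suc n) ≢ Field.0# F

Infinite : Set → Set
Infinite A = (l : List A) → ∃[ x ] (x ∉ l)

record Algebra : Set₁ where
  field
    I    : Set
    A    : I → Set                     -- the phyla (disjoint as types)
    inh  : (ξ : I) → A ξ
    K    : Set
    dom  : K → List I
    cod  : K → I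
    fun  : (k : K) → All A (dom k) → A (cod k)

module AlgebraTheory (𝔄 : Algebra) where
  open Algebra 𝔄

  -- an element of the union of the phyla
  El : Set
  El = Σ I A

  -- orderly terms: OT xs ξ is an orderly term with argument sorts xs and
  -- value sort ξ. 'var' is id_{A_ξ}; 'app g (h₁ ∷ … ∷ hN ∷ [])' is
  -- g(h₁(x⃗₁),…,h_N(x⃗_N)) with argument list x⃗₁ * ⋯ * x⃗_N.
  data OT : List I → I → Set
  data Args : List I → List I → Set

  data OT where
    var : (ξ : I) → OT (ξ ∷ []) ξ
    app : (k : K) {xs : List I} → Args xs (dom k) → OT xs (cod k)

  data Args where
    []  : Args [] []
    _∷_ : ∀ {xs ys ξ ds} → OT xs ξ → Args ys ds → Args (xs ++ ys) (ξ ∷ ds)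

  splitAll : ∀ (xs : List I) {ys} → All A (xs ++ ys) → All A xs × All A ys
  splitAll [] vs = [] , vs
  splitAll (x ∷ xs) (v ∷ vs) with splitAll xs vs
  ... | p , q = (v ∷ p) , q

  eval : ∀ {xs ξ} → OT xs ξ → All A xs → A ξ
  evalArgs : ∀ {xs ds} → Args xs ds → All A xs → All A ds

  eval (var ξ) (v ∷ []) = v
  eval (app k as) vs = fun k (evalArgs as vs)

  evalArgs [] [] = []
  evalArgs (_∷_ {xs} t as) vs with splitAll xs vs
  ... | p , q = eval t p ∷ evalArgs as q

  toAll : (es : List El) → All A (map proj₁ es)
  toAll [] = []
  toAll ((ξ , x) ∷ es) = x ∷ toAll es

  Seq : Set
  Seq = ℕ → El

  Sort : Set
  Sort = ℕ → I

  Sorted : Sort → Seq → Set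
  Sorted e b = ∀ i → proj₁ (b i) ≡ e i

  RepBy : Seq → List ℕ → El → Set
  RepBy b ℓ x = Σ[ ξ ∈ I ] Σ[ f ∈ OT (map proj₁ (map b ℓ)) ξ ]
                  (x ≡ (ξ , eval f (toAll (map b ℓ))))

  -- the concatenation ℓ 0 * ℓ 1 * ⋯ of index lists is strictly increasing,
  -- i.e. b⃗₀ * b⃗₁ * ⋯ is a subsequence of b
  ConcatIncreasing : (ℕ → List ℕ) → Set
  ConcatIncreasing ℓ =
    (∀ j → Linked _<_ (ℓ j)) ×
    (∀ j j′ → j < j′ → ∀ {x y} → x ∈ ℓ j → y ∈ ℓ j′ → x < y)

  _≤𝓕_ : Seq → Seq → Set
  a ≤𝓕 b = Σ[ ℓ ∈ (ℕ → List ℕ) ] ((∀ j → RepBy b (ℓ j) (a j)) × ConcatIncreasing ℓ)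

  InFR : (e : Sort) → Seq → A (e 0) → Set
  InFR e b x = Σ[ a ∈ Seq ] (a ≤𝓕 b × Sorted e a × a 0 ≡ (e 0 , x))

  IsRamsey : Sort → Set₁
  IsRamsey e = (b : Seq) → Sorted e b → (X : A (e 0) → Set) →
    Σ[ a ∈ Seq ] (Sorted e a × a ≤𝓕 b ×
      ((∀ x → InFR e a x → X x) ⊎ (∀ x → InFR e a x → ¬ X x)))

  InΩ : Sort → Set
  InΩ e = ∀ i n → ∃[ m ] (n ≤ m × e m ≡ e i)

  Nonconstant : Sort → Set
  Nonconstant e = ∃[ i ] (e i ≢ e 0)

module MatrixAlgebra (F : Field) (n : ℕ) where
  open Field F

  Matrix : ℕ → Set
  Matrix m = Vec (Vec Carrier m) m

  _+M_ : Matrix n → Matrix n → Matrix n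
  M +M N = zipWith (zipWith _+_) M N

  sumF : ∀ {m} → Vec Carrier m → Carrier
  sumF = foldr′ _+_ 0#

  _×M_ : Matrix n → Matrix n → Matrix n
  M ×M N = tabulate λ i → tabulate λ j →
             sumF (tabulate λ k → lookup (lookup M i) k * lookup (lookup N k) j)

  sgn : ℕ → Carrier
  sgn zero = 1#
  sgn (suc j) = - sgn j

  det : ∀ m → Matrix m → Carrier
  det zero _ = 1#
  det (suc m) (r ∷ rs) =
    sumF (tabulate λ (j : Fin (suc m)) →
      sgn (Data.Fin.toℕ j) * lookup r j * det m (Data.Vec.map (λ row → removeAt row j) rs))

  Phy : Fin 2 → Set
  Phy zero = Carrier
  Phy (suc zero) = Matrix n

  data Op : Set where
    addM mulM addF mulF detM : Op

  opDom : Op → List (Fin 2)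
  opDom addM = suc zero ∷ suc zero ∷ []
  opDom mulM = suc zero ∷ suc zero ∷ []
  opDom addF = zero ∷ zero ∷ []
  opDom mulF = zero ∷ zero ∷ []
  opDom detM = suc zero ∷ []

  opCod : Op → Fin 2
  opCod addM = suc zero
  opCod mulM = suc zero
  opCod addF = zero
  opCod mulF = zero
  opCod detM = zero

  opFun : (o : Op) → All Phy (opDom o) → Phy (opCod o)
  opFun addM (M ∷ N ∷ []) = M +M N
  opFun mulM (M ∷ N ∷ []) = M ×M N
  opFun addF (x ∷ y ∷ []) = x + y
  opFun mulF (x ∷ y ∷ []) = x * y
  opFun detM (M ∷ []) = det n M

  inhPhy : (ξ : Fin 2) → Phy ξ
  inhPhy zero = 0#
  inhPhy (suc zero) = Data.Vec.replicate n (Data.Vec.replicate n 0#)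

  MatAlg : List Op → Algebra
  MatAlg S = record
    { I = Fin 2 ; A = Phy ; inh = inhPhy
    ; K = Σ[ o ∈ Op ] (o ∈ S)
    ; dom = λ k → opDom (proj₁ k)
    ; cod = λ k → opCod (proj₁ k)
    ; fun = λ k → opFun (proj₁ k) }

  families : List (List Op)
  families = (addM ∷ mulM ∷ detM ∷ [])
           ∷ (addM ∷ mulM ∷ addF ∷ detM ∷ [])
           ∷ (addM ∷ mulM ∷ mulF ∷ detM ∷ [])
           ∷ (addM ∷ mulM ∷ addF ∷ mulF ∷ detM ∷ [])
           ∷ []

module Submission where

open import Defs
open import Data.Nat using (ℕ; suc)
open import Data.Fin using (zero)
open import Data.List using (List)
open import Data.List.Membership.Propositional using (_∈_)
open import Relation.Binary.PropositionalEquality using (_≡_)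
open import Relation.Nullary using (¬_)
open import Data.Fin using (suc)
open import Data.Product using (_×_; _,_)
open import Data.Empty using (⊥-elim)
open import Data.List.Relation.Unary.Any using (here; there)
open import Relation.Binary.PropositionalEquality using (refl; sym; trans)

-- Let b be the test sequence whose entry at a matrix position i is the
-- scalar matrix 2^(2^i)·I. A matrix-valued orderly term only uses + and ×, so on the
-- test entries at positions in a block [L, U) it evaluates to V·I, where V is a sum
-- of distinct powers 2^c whose positions c are "codes" of [L, U): positive multiples
-- of 2^L below 2^U (a block number).  For V, W block numbers of adjacent blocks
-- [0, s) and [s, U), the binary digits of V + W are those of V followed by those of
-- W, while those of V·W are the sums p + q, none of which is a multiple of 2^s.
-- Hence colouring det(V·I) = (V·1)^n by "V is split" (lowest digit < 2^t ∣ highest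
-- digit, for some t) separates det(M + N) from det(M × N) for any two matrix entries
-- M, N of a sequence a ≤ b, and both determinants lie in FR(a); char 0 makes the
-- colouring well defined.  So no a ≤ b is monochromatic.

pattern 𝓜 = suc zero

module Binary where
  open import Data.Nat
  open import Data.Nat.Properties
  open import Data.Nat.Divisibility
  open import Data.List using (List; []; _∷_)
  open import Data.Unit using (⊤)
  open import Data.Product using (∃-syntax; _×_; _,_)
  open import Relation.Binary.PropositionalEquality
  open import Relation.Binary.Definitions using (tri<; tri≈; tri>)
  open import Relation.Nullary using (contradiction)
  open import Data.Nat.Tactic.RingSolver using (solve-∀)

  val : List ℕ → ℕ
  val []       = 0
  val (c ∷ cs) = 2 ^ c + val cs

  IncFrom : ℕ → List ℕ → Set
  IncFrom b []       = ⊤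
  IncFrom b (c ∷ cs) = b ≤ c × IncFrom (suc c) cs

  lastL : ℕ → List ℕ → ℕ
  lastL c []       = c
  lastL c (d ∷ ds) = lastL d ds

  LowBit : ℕ → ℕ → Set
  LowBit V lo = ∃[ k ] (V ≡ 2 ^ lo * suc (2 * k))

  HighBit : ℕ → ℕ → Set
  HighBit V hi = 2 ^ hi ≤ V × V < 2 ^ suc hi

  pow-∣ : ∀ {a b} → a ≤ b → 2 ^ a ∣ 2 ^ b
  pow-∣ {a} {b} a≤b =
    divides (2 ^ (b ∸ a)) (trans (cong (2 ^_) (sym (m∸n+n≡m a≤b))) (^-distribˡ-+-* 2 (b ∸ a) a))

  -- the lowest digit is unique: compare 2-adic valuations by halving
  lowBit-unique : ∀ {V} a b → LowBit V a → LowBit V b → a ≡ b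
  lowBit-unique zero    zero    _       _        = refl
  lowBit-unique zero    (suc b) (k , p) (k′ , q) =
    contradiction (trans (sym (*-assoc 2 (2 ^ b) _)) (trans (sym q) (trans p (*-identityˡ _))))
                  (even≢odd (2 ^ b * suc (2 * k′)) k)
  lowBit-unique (suc a) zero    p       q        = sym (lowBit-unique zero (suc a) q p)
  lowBit-unique (suc a) (suc b) (k , p) (k′ , q) = cong suc (lowBit-unique a b (k , refl) (k′ , halves))
    where
    halves : 2 ^ a * suc (2 * k) ≡ 2 ^ b * suc (2 * k′)
    halves = *-cancelˡ-≡ _ _ 2
      (trans (sym (*-assoc 2 (2 ^ a) _)) (trans (sym p) (trans q (*-assoc 2 (2 ^ b) _))))

  -- the highest digit is unique: the intervals [2^hi, 2^(hi+1)) are disjoint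
  highBit-unique : ∀ {V a b} → HighBit V a → HighBit V b → a ≡ b
  highBit-unique {V} {a} {b} (2^a≤V , V<2^1+a) (2^b≤V , V<2^1+b) with <-cmp a b
  ... | tri< a<b _ _ = contradiction (≤-trans (^-monoʳ-≤ 2 a<b) 2^b≤V) (<⇒≱ V<2^1+a)
  ... | tri≈ _ a≡b _ = a≡b
  ... | tri> _ _ b<a = contradiction (≤-trans (^-monoʳ-≤ 2 b<a) 2^a≤V) (<⇒≱ V<2^1+b)

  val-divisible : ∀ {b} cs → IncFrom b cs → 2 ^ b ∣ val cs
  val-divisible []       _           = _ ∣0
  val-divisible (c ∷ cs) (b≤c , inc) =
    ∣m∣n⇒∣m+n (pow-∣ b≤c) (∣-trans (pow-∣ (≤-trans b≤c (n≤1+n c))) (val-divisible cs inc))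

  val-lowBit : ∀ {b} c cs → IncFrom b (c ∷ cs) → LowBit (val (c ∷ cs)) c
  val-lowBit c cs (_ , inc) with val-divisible cs inc
  ... | divides q eq = q , (begin
      2 ^ c + val cs          ≡⟨ cong (2 ^ c +_) eq ⟩
      2 ^ c + q * (2 * 2 ^ c) ≡⟨ factor (2 ^ c) q ⟩
      2 ^ c * suc (2 * q)     ∎)
    where
    open ≡-Reasoning
    factor : ∀ x q → x + q * (2 * x) ≡ x * suc (2 * q)
    factor = solve-∀

  val-lower : ∀ c cs → 2 ^ lastL c cs ≤ val (c ∷ cs)
  val-lower c []       = m≤m+n (2 ^ c) 0
  val-lower c (d ∷ ds) = ≤-trans (val-lower d ds) (m≤n+m (val (d ∷ ds)) (2 ^ c))

  val-upper : ∀ {b} c cs → IncFrom b (c ∷ cs) → val (c ∷ cs) + 2 ^ b ≤ 2 ^ suc (lastL c cs)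
  val-upper {b} c [] (b≤c , _) = begin
      2 ^ c + 0 + 2 ^ b ≤⟨ +-monoʳ-≤ (2 ^ c + 0) (^-monoʳ-≤ 2 b≤c) ⟩
      2 ^ c + 0 + 2 ^ c ≡⟨ double (2 ^ c) ⟩
      2 * 2 ^ c         ∎
    where
    open ≤-Reasoning
    double : ∀ x → x + 0 + x ≡ 2 * x
    double = solve-∀
  val-upper {b} c (d ∷ ds) (b≤c , inc) = begin
      2 ^ c + val (d ∷ ds) + 2 ^ b ≤⟨ +-monoʳ-≤ (2 ^ c + val (d ∷ ds)) (^-monoʳ-≤ 2 b≤c) ⟩
      2 ^ c + val (d ∷ ds) + 2 ^ c ≡⟨ regroup (2 ^ c) (val (d ∷ ds)) ⟩
      val (d ∷ ds) + 2 ^ suc c     ≤⟨ val-upper d ds inc ⟩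
      2 ^ suc (lastL d ds)         ∎
    where
    open ≤-Reasoning
    regroup : ∀ x v → x + v + x ≡ v + 2 * x
    regroup = solve-∀

  val-highBit : ∀ {b} c cs → IncFrom b (c ∷ cs) → HighBit (val (c ∷ cs)) (lastL c cs)
  val-highBit {b} c cs inc =
    val-lower c cs , <-≤-trans (m<m+n (val (c ∷ cs)) (m^n>0 2 b)) (val-upper c cs inc)

module Blocks where
  open import Data.Nat
  open import Data.Nat.Properties
  open import Data.Nat.Divisibility
  open import Data.List using (List; []; _∷_; _++_; map)
  open import Data.List.Relation.Unary.All using (All; []; _∷_)
  import Data.List.Relation.Unary.All as All
  open import Data.List.Relation.Unary.All.Properties using (++⁺; map⁺)
  open import Data.Unit using (tt)
  open import Data.Product using (∃-syntax; _×_; _,_; proj₁; proj₂)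
  open import Relation.Binary.PropositionalEquality
  open import Relation.Nullary using (¬_)
  open Binary

  -- a code of the block of positions [L, U): a positive multiple of 2^L below 2^U,
  -- i.e. a nonempty sum of distinct powers 2^i with L ≤ i < U
  record Code (L U c : ℕ) : Set where
    constructor code
    field
      divisible : 2 ^ L ∣ c
      positive  : 0 < c
      bounded   : c < 2 ^ U

  code-lower : ∀ {L U c} → Code L U c → 2 ^ L ≤ c
  code-lower (code 2^L∣c 0<c _) = ∣⇒≤ {{>-nonZero 0<c}} 2^L∣c

  code-widenˡ : ∀ {L′ L U c} → L′ ≤ L → Code L U c → Code L′ U c
  code-widenˡ L′≤L (code d p b) = code (∣-trans (pow-∣ L′≤L) d) p b

  code-widenʳ : ∀ {L U U′ c} → U ≤ U′ → Code L U c → Code L U′ c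
  code-widenʳ U≤U′ (code d p b) = code d p (<-≤-trans b (^-monoʳ-≤ 2 U≤U′))

  data BlockNumber (L U : ℕ) : ℕ → Set where
    block : ∀ c cs → IncFrom 0 (c ∷ cs) → All (Code L U) (c ∷ cs) → BlockNumber L U (val (c ∷ cs))

  block-single : ∀ {L U i} → L ≤ i → i < U → BlockNumber L U (val (2 ^ i ∷ []))
  block-single {i = i} L≤i i<U =
    block (2 ^ i) [] (z≤n , tt) (code (pow-∣ L≤i) (m^n>0 2 i) (^-monoʳ-< 2 (s≤s (s≤s z≤n)) i<U) ∷ [])

  inc-weaken : ∀ {b′ b} cs → b′ ≤ b → IncFrom b cs → IncFrom b′ cs
  inc-weaken []       _    _          = tt
  inc-weaken (c ∷ cs) b′≤b (b≤c , inc) = ≤-trans b′≤b b≤c , inc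

  inc-++ : ∀ {b u} xs ys → IncFrom b xs → All (_< u) xs → b ≤ u → IncFrom u ys → IncFrom b (xs ++ ys)
  inc-++ []       ys _           _            b≤u incʸ = inc-weaken ys b≤u incʸ
  inc-++ (x ∷ xs) ys (b≤x , incˣ) (x<u ∷ xs<u) _  incʸ = b≤x , inc-++ xs ys incˣ xs<u x<u incʸ

  inc-split : ∀ {L} xs s r → IncFrom L (xs ++ s ∷ r) → IncFrom L xs × All (_< s) xs × L ≤ s × IncFrom s (s ∷ r)
  inc-split []       s r (L≤s , inc) = tt , [] , L≤s , (≤-refl , inc)
  inc-split (x ∷ xs) s r (L≤x , inc) with inc-split xs s r inc
  ... | incˣ , xs<s , x<s , incˢ = (L≤x , incˣ) , x<s ∷ xs<s , ≤-trans L≤x (<⇒≤ x<s) , incˢ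

  inc-++⁻ˡ : ∀ {b} xs {ys} → IncFrom b (xs ++ ys) → IncFrom b xs
  inc-++⁻ˡ []       _           = tt
  inc-++⁻ˡ (x ∷ xs) (b≤x , inc) = b≤x , inc-++⁻ˡ xs inc

  val-++ : ∀ xs ys → val (xs ++ ys) ≡ val xs + val ys
  val-++ []       ys = refl
  val-++ (x ∷ xs) ys = trans (cong (2 ^ x +_) (val-++ xs ys)) (sym (+-assoc (2 ^ x) (val xs) (val ys)))

  lastL-++ : ∀ c xs d ds → lastL c (xs ++ d ∷ ds) ≡ lastL d ds
  lastL-++ c []       d ds = refl
  lastL-++ c (x ∷ xs) d ds = lastL-++ x xs d ds

  lastL-All : ∀ {P : ℕ → Set} c cs → All P (c ∷ cs) → P (lastL c cs)
  lastL-All c []       (p ∷ []) = p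
  lastL-All c (d ∷ ds) (_ ∷ ps) = lastL-All d ds ps

  -- Sums. The digits of a block number of [L, s) all lie below those of a block
  -- number of [s, U), so the sum has the concatenated digit list.
  concat-increasing : ∀ {L s U} c₁ cs₁ c₂ cs₂ →
    IncFrom 0 (c₁ ∷ cs₁) → All (Code L s) (c₁ ∷ cs₁) →
    IncFrom 0 (c₂ ∷ cs₂) → All (Code s U) (c₂ ∷ cs₂) →
    IncFrom 0 ((c₁ ∷ cs₁) ++ (c₂ ∷ cs₂))
  concat-increasing c₁ cs₁ c₂ cs₂ inc₁ codes₁ (_ , inc₂) (code₂ ∷ _) =
    inc-++ (c₁ ∷ cs₁) (c₂ ∷ cs₂) inc₁ (All.map Code.bounded codes₁) z≤n (code-lower code₂ , inc₂)

  block-+ : ∀ {L s U V W} → L ≤ s → s ≤ U → BlockNumber L s V → BlockNumber s U W → BlockNumber L U (V + W)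
  block-+ L≤s s≤U (block c₁ cs₁ inc₁ codes₁) (block c₂ cs₂ inc₂ codes₂) =
    subst (BlockNumber _ _) (val-++ (c₁ ∷ cs₁) (c₂ ∷ cs₂))
      (block c₁ (cs₁ ++ c₂ ∷ cs₂) (concat-increasing c₁ cs₁ c₂ cs₂ inc₁ codes₁ inc₂ codes₂)
        (++⁺ (All.map (code-widenʳ s≤U) codes₁) (All.map (code-widenˡ L≤s) codes₂)))

  -- Products. (Σ_p 2^p)(Σ_q 2^q) = Σ_{p,q} 2^(p+q); the digit positions p + q are
  -- listed block by block in q.
  prod : List ℕ → List ℕ → List ℕ
  prod xs []       = []
  prod xs (q ∷ qs) = map (_+ q) xs ++ prod xs qs

  val-shift : ∀ q xs → val (map (_+ q) xs) ≡ val xs * 2 ^ q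
  val-shift q []       = refl
  val-shift q (x ∷ xs) = begin
      2 ^ (x + q) + val (map (_+ q) xs) ≡⟨ cong₂ _+_ (^-distribˡ-+-* 2 x q) (val-shift q xs) ⟩
      2 ^ x * 2 ^ q + val xs * 2 ^ q    ≡⟨ sym (*-distribʳ-+ (2 ^ q) (2 ^ x) (val xs)) ⟩
      (2 ^ x + val xs) * 2 ^ q          ∎
    where open ≡-Reasoning

  val-prod : ∀ xs ys → val (prod xs ys) ≡ val xs * val ys
  val-prod xs []       = sym (*-zeroʳ (val xs))
  val-prod xs (q ∷ qs) = begin
      val (map (_+ q) xs ++ prod xs qs)      ≡⟨ val-++ (map (_+ q) xs) (prod xs qs) ⟩
      val (map (_+ q) xs) + val (prod xs qs) ≡⟨ cong₂ _+_ (val-shift q xs) (val-prod xs qs) ⟩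
      val xs * 2 ^ q + val xs * val qs       ≡⟨ sym (*-distribˡ-+ (val xs) (2 ^ q) (val qs)) ⟩
      val xs * (2 ^ q + val qs)              ∎
    where open ≡-Reasoning

  all-prod : ∀ {P Q R : ℕ → Set} {xs ys} → All P xs → All Q ys →
    (∀ {p q} → P p → Q q → R (p + q)) → All R (prod xs ys)
  all-prod Pxs []         f = []
  all-prod Pxs (Qq ∷ Qqs) f = ++⁺ (map⁺ (All.map (λ Pp → f Pp Qq) Pxs)) (all-prod Pxs Qqs f)

  inc-shift : ∀ {b} q cs → IncFrom b cs → IncFrom (b + q) (map (_+ q) cs)
  inc-shift q []       _         = tt
  inc-shift q (c ∷ cs) (b≤c , inc) = +-monoˡ-≤ q b≤c , inc-shift q cs inc

  ∣-gap : ∀ {a x y} → a ∣ x → a ∣ y → x < y → x + a ≤ y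
  ∣-gap {a} {x} {y} a∣x a∣y x<y = begin
      x + a       ≤⟨ +-monoʳ-≤ x (∣⇒≤ {{>-nonZero (m<n⇒0<n∸m x<y)}} a∣y∸x) ⟩
      x + (y ∸ x) ≡⟨ m+[n∸m]≡n (<⇒≤ x<y) ⟩
      y           ∎
    where
    open ≤-Reasoning
    a∣y∸x : a ∣ y ∸ x
    a∣y∸x = ∣m+n∣m⇒∣n (subst (a ∣_) (sym (m+[n∸m]≡n (<⇒≤ x<y))) a∣y) a∣x

  -- if xs lies below 2^s and ys are increasing multiples of 2^s, the product positions
  -- are increasing: the shifted copies x + q of xs do not overlap
  inc-prod : ∀ s xs → IncFrom 0 xs → All (_< 2 ^ s) xs →
    ∀ {B} ys → IncFrom B ys → All (2 ^ s ∣_) ys → IncFrom B (prod xs ys)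
  inc-prod s xs incˣ xs< []       _            _            = tt
  inc-prod s xs incˣ xs< (q ∷ qs) (B≤q , incq) (2^s∣q ∷ ∣qs) =
    inc-++ (map (_+ q) xs) (prod xs qs)
      (inc-weaken (map (_+ q) xs) B≤q (inc-shift q xs incˣ))
      (map⁺ (All.map (λ {x} x<2^s → subst (x + q <_) (+-comm (2 ^ s) q) (+-monoˡ-< q x<2^s)) xs<))
      (≤-trans B≤q (m≤m+n q (2 ^ s)))
      (inc-prod s xs incˣ xs< qs (next-block qs incq ∣qs) ∣qs)
    where
    next-block : ∀ qs → IncFrom (suc q) qs → All (2 ^ s ∣_) qs → IncFrom (q + 2 ^ s) qs
    next-block []        _              _           = tt
    next-block (q′ ∷ qs) (q<q′ , inc) (2^s∣q′ ∷ _) = ∣-gap 2^s∣q 2^s∣q′ q<q′ , inc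

  prod-increasing : ∀ {L s U} c₁ cs₁ c₂ cs₂ →
    IncFrom 0 (c₁ ∷ cs₁) → All (Code L s) (c₁ ∷ cs₁) →
    IncFrom 0 (c₂ ∷ cs₂) → All (Code s U) (c₂ ∷ cs₂) →
    IncFrom 0 (prod (c₁ ∷ cs₁) (c₂ ∷ cs₂))
  prod-increasing {s = s} c₁ cs₁ c₂ cs₂ inc₁ codes₁ inc₂ codes₂ =
    inc-prod s (c₁ ∷ cs₁) inc₁ (All.map Code.bounded codes₁) (c₂ ∷ cs₂) inc₂ (All.map Code.divisible codes₂)

  block-* : ∀ {L s U V W} → L ≤ s → s ≤ U → BlockNumber L s V → BlockNumber s U W → BlockNumber L U (V * W)
  block-* {L} {s} {U} L≤s s≤U (block c₁ cs₁ inc₁ codes₁) (block c₂ cs₂ inc₂ codes₂) =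
    subst (BlockNumber _ _) (val-prod (c₁ ∷ cs₁) (c₂ ∷ cs₂))
      (block (c₁ + c₂) _
        (prod-increasing c₁ cs₁ c₂ cs₂ inc₁ codes₁ inc₂ codes₂)
        (all-prod codes₁ codes₂ code-+))
    where
    code-+ : ∀ {p q} → Code L s p → Code s U q → Code L U (p + q)
    code-+ {p} {q} (code 2^L∣p 0<p p<2^s) (code 2^s∣q _ q<2^U) = code
      (∣m∣n⇒∣m+n 2^L∣p (∣-trans (pow-∣ L≤s) 2^s∣q))
      (<-≤-trans 0<p (m≤m+n p q))
      (begin-strict
        p + q     <⟨ +-monoˡ-< q p<2^s ⟩
        2 ^ s + q ≡⟨ +-comm (2 ^ s) q ⟩
        q + 2 ^ s ≤⟨ ∣-gap 2^s∣q (pow-∣ s≤U) q<2^U ⟩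
        2 ^ U     ∎)
      where open ≤-Reasoning

  -- V is split: its lowest digit lies below some 2^t that divides the position of
  -- its highest digit.  This is the colouring that separates sums from products.
  Split : ℕ → Set
  Split V = ∃[ lo ] ∃[ hi ] ∃[ t ] (LowBit V lo × HighBit V hi × lo < 2 ^ t × 2 ^ t ∣ hi)

  -- sums across adjacent blocks are split, with t = s: the lowest digit is a code
  -- of [L, s) and the highest one a code of [s, U)
  block-+-split : ∀ {L s U V W} → BlockNumber L s V → BlockNumber s U W → Split (V + W)
  block-+-split {s = s} (block c₁ cs₁ inc₁ codes₁) (block c₂ cs₂ inc₂ codes₂) =
    subst Split (val-++ (c₁ ∷ cs₁) (c₂ ∷ cs₂))
      ( c₁ , lastL c₂ cs₂ , s
      , val-lowBit c₁ (cs₁ ++ c₂ ∷ cs₂) inc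
      , subst (HighBit _) (lastL-++ c₁ cs₁ c₂ cs₂) (val-highBit c₁ (cs₁ ++ c₂ ∷ cs₂) inc)
      , Code.bounded (All.head codes₁)
      , Code.divisible (lastL-All c₂ cs₂ codes₂))
    where
    inc = concat-increasing c₁ cs₁ c₂ cs₂ inc₁ codes₁ inc₂ codes₂

  Straddles : ℕ → ℕ → Set
  Straddles s d = 2 ^ s ≤ d × ¬ (2 ^ s ∣ d)

  -- if all digit positions straddle s, the number is not split: the lowest position
  -- is ≥ 2^s, so any admissible t exceeds s, and then 2^s would divide the highest one
  straddling-notSplit : ∀ {b} s c cs → IncFrom b (c ∷ cs) → All (Straddles s) (c ∷ cs) → ¬ Split (val (c ∷ cs))
  straddling-notSplit s c cs inc strad (lo , hi , t , low , high , lo<2^t , 2^t∣hi) =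
    proj₂ (lastL-All c cs strad) (∣-trans (pow-∣ (<⇒≤ s<t)) (subst (2 ^ t ∣_) hi≡last 2^t∣hi))
    where
    hi≡last : hi ≡ lastL c cs
    hi≡last = highBit-unique high (val-highBit c cs inc)
    2^s<2^t : 2 ^ s < 2 ^ t
    2^s<2^t = ≤-<-trans (proj₁ (All.head strad)) (subst (_< 2 ^ t) (lowBit-unique lo c low (val-lowBit c cs inc)) lo<2^t)
    s<t : s < t
    s<t = ≰⇒> (λ t≤s → <⇒≱ 2^s<2^t (^-monoʳ-≤ 2 t≤s))

  -- products across adjacent blocks are not split: every position p + q straddles s
  block-*-notSplit : ∀ {L s U V W} → BlockNumber L s V → BlockNumber s U W → ¬ Split (V * W)
  block-*-notSplit {s = s} (block c₁ cs₁ inc₁ codes₁) (block c₂ cs₂ inc₂ codes₂) =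
    subst (λ V → ¬ Split V) (val-prod (c₁ ∷ cs₁) (c₂ ∷ cs₂))
      (straddling-notSplit s (c₁ + c₂) _
        (prod-increasing c₁ cs₁ c₂ cs₂ inc₁ codes₁ inc₂ codes₂)
        (all-prod codes₁ codes₂ straddle))
    where
    straddle : ∀ {L U p q} → Code L s p → Code s U q → Straddles s (p + q)
    straddle {p = p} {q} (code _ 0<p p<2^s) q-code@(code 2^s∣q _ _) =
        ≤-trans (code-lower q-code) (m≤n+m q p)
      , λ 2^s∣p+q → <⇒≱ p<2^s (∣⇒≤ {{>-nonZero 0<p}} (∣m+n∣m⇒∣n (subst (2 ^ s ∣_) (+-comm p q) 2^s∣p+q) 2^s∣q))

module FieldNumerals (F : Field) where
  open import Data.Nat using (zero)
  import Data.Nat as ℕ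
  import Data.Nat.Properties as ℕₚ
  open import Data.Empty using (⊥-elim)
  open import Relation.Binary.PropositionalEquality
  open import Relation.Binary.Definitions using (tri<; tri≈; tri>)
  open import Algebra.Structures using (IsCommutativeRing)
  open Field F
  open IsCommutativeRing isCommutativeRing
    using (+-assoc; +-identityˡ; +-identityʳ; -‿inverseˡ; *-identityˡ; zeroˡ; distribʳ)
  open ≡-Reasoning

  ·1-+ : ∀ a b → (a ℕ.+ b) ·1 ≡ a ·1 + b ·1
  ·1-+ zero    b = sym (+-identityˡ (b ·1))
  ·1-+ (suc a) b = trans (cong (1# +_) (·1-+ a b)) (sym (+-assoc 1# (a ·1) (b ·1)))

  ·1-* : ∀ a b → (a ℕ.* b) ·1 ≡ a ·1 * b ·1
  ·1-* zero    b = sym (zeroˡ (b ·1))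
  ·1-* (suc a) b = begin
    (b ℕ.+ a ℕ.* b) ·1        ≡⟨ ·1-+ b (a ℕ.* b) ⟩
    b ·1 + (a ℕ.* b) ·1       ≡⟨ cong₂ _+_ (sym (*-identityˡ (b ·1))) (·1-* a b) ⟩
    1# * b ·1 + a ·1 * b ·1   ≡⟨ sym (distribʳ (b ·1) 1# (a ·1)) ⟩
    (1# + a ·1) * b ·1        ∎

  pow : ℕ → Carrier → Carrier
  pow zero    x = 1#
  pow (suc k) x = x * pow k x

  ·1-^ : ∀ k V → pow k (V ·1) ≡ (V ℕ.^ k) ·1
  ·1-^ zero    V = sym (+-identityʳ 1#)
  ·1-^ (suc k) V = trans (cong (V ·1 *_) (·1-^ k V)) (sym (·1-* V (V ℕ.^ k)))

  +-cancelˡ : ∀ x y z → x + y ≡ x + z → y ≡ z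
  +-cancelˡ x y z x+y≡x+z = begin
    y              ≡⟨ sym (+-identityˡ y) ⟩
    0# + y         ≡⟨ cong (_+ y) (sym (-‿inverseˡ x)) ⟩
    (- x + x) + y  ≡⟨ +-assoc (- x) x y ⟩
    - x + (x + y)  ≡⟨ cong (- x +_) x+y≡x+z ⟩
    - x + (x + z)  ≡⟨ sym (+-assoc (- x) x z) ⟩
    (- x + x) + z  ≡⟨ cong (_+ z) (-‿inverseˡ x) ⟩
    0# + z         ≡⟨ +-identityˡ z ⟩
    z              ∎

  ^-injectiveˡ : ∀ k {V W} → V ℕ.^ suc k ≡ W ℕ.^ suc k → V ≡ W
  ^-injectiveˡ k {V} {W} eq with ℕₚ.<-cmp V W
  ... | tri< V<W _ _ = ⊥-elim (ℕₚ.<-irrefl eq (ℕₚ.^-monoˡ-< (suc k) V<W))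
  ... | tri≈ _ V≡W _ = V≡W
  ... | tri> _ _ W<V = ⊥-elim (ℕₚ.<-irrefl (sym eq) (ℕₚ.^-monoˡ-< (suc k) W<V))

  module _ (charZero : CharZero F) where

    ·1-injective : ∀ a b → a ·1 ≡ b ·1 → a ≡ b
    ·1-injective zero    zero    _  = refl
    ·1-injective zero    (suc b) eq = ⊥-elim (charZero b (sym eq))
    ·1-injective (suc a) zero    eq = ⊥-elim (charZero a eq)
    ·1-injective (suc a) (suc b) eq = cong suc (·1-injective a b (+-cancelˡ 1# (a ·1) (b ·1) eq))

    pow-·1-injective : ∀ k V W → pow (suc k) (V ·1) ≡ pow (suc k) (W ·1) → V ≡ W
    pow-·1-injective k V W eq =
      ^-injectiveˡ k (·1-injective _ _ (trans (sym (·1-^ (suc k) V)) (trans eq (·1-^ (suc k) W))))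

module ScalarMatrices (F : Field) (n : ℕ) where
  open import Data.Nat using (zero)
  open import Data.Fin using (Fin; zero; suc; toℕ)
  open import Data.Vec using (_∷_; tabulate; lookup; removeAt; zipWith)
  import Data.Vec as Vec
  open import Data.Vec.Properties using (lookup∘tabulate; tabulate-cong; tabulate-∘)
  open import Relation.Binary.PropositionalEquality
  open import Algebra.Structures using (IsCommutativeRing)
  open Field F
  open IsCommutativeRing isCommutativeRing
    using (+-identityˡ; +-identityʳ; *-identityˡ; zeroˡ; zeroʳ)
  open MatrixAlgebra F n
  open FieldNumerals F using (pow)
  open ≡-Reasoning

  δ : ∀ {k} → Fin k → Fin k → Carrier → Carrier
  δ zero    zero    c = c
  δ zero    (suc j) c = 0#
  δ (suc i) zero    c = 0#
  δ (suc i) (suc j) c = δ i j c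

  scalarOf : ∀ k → Carrier → Matrix k
  scalarOf k c = tabulate λ i → tabulate λ j → δ i j c

  scalar : Carrier → Matrix n
  scalar = scalarOf n

  sum-zero : ∀ {k} (g : Fin k → Carrier) → (∀ j → g j ≡ 0#) → sumF (tabulate g) ≡ 0#
  sum-zero {zero}  g g≡0 = refl
  sum-zero {suc k} g g≡0 = trans (cong₂ _+_ (g≡0 zero) (sum-zero (λ j → g (suc j)) (λ j → g≡0 (suc j)))) (+-identityˡ 0#)

  -- Laplace expansion along the first row of c·I: only the diagonal entry
  -- contributes, and its minor is c·I of one size smaller
  det-scalar : ∀ k c → det k (scalarOf k c) ≡ pow k c
  det-scalar zero    c = refl
  det-scalar (suc k) c = begin
      term zero + sumF (tabulate (λ j → term (suc j)))
        ≡⟨ cong₂ _+_ diagonal (sum-zero (λ j → term (suc j)) off-diagonal) ⟩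
      c * pow k c + 0#
        ≡⟨ +-identityʳ _ ⟩
      c * pow k c ∎
    where
    row₀ = tabulate λ j → δ {suc k} zero j c
    rows = tabulate λ i → tabulate λ j → δ {suc k} (suc i) j c
    minor : Fin (suc k) → Matrix k
    minor j = Vec.map (λ row → removeAt row j) rows
    term : Fin (suc k) → Carrier
    term j = sgn (toℕ j) * lookup row₀ j * det k (minor j)
    diagonal : term zero ≡ c * pow k c
    diagonal = cong₂ _*_ (*-identityˡ c)
      (trans (cong (det k) (sym (tabulate-∘ (λ row → removeAt row zero) _))) (det-scalar k c))
    off-diagonal : ∀ j → term (suc j) ≡ 0#
    off-diagonal j = begin
      sgn (toℕ (suc j)) * lookup row₀ (suc j) * det k (minor (suc j))
        ≡⟨ cong (λ x → sgn (toℕ (suc j)) * x * det k (minor (suc j))) (lookup∘tabulate (λ j → δ {suc k} zero j c) (suc j)) ⟩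
      sgn (toℕ (suc j)) * 0# * det k (minor (suc j))
        ≡⟨ cong (_* det k (minor (suc j))) (zeroʳ _) ⟩
      0# * det k (minor (suc j))
        ≡⟨ zeroˡ _ ⟩
      0# ∎

  zipWith-tabulate : ∀ {A B C : Set} {k} (f : A → B → C) (g : Fin k → A) (h : Fin k → B) →
    zipWith f (tabulate g) (tabulate h) ≡ tabulate (λ i → f (g i) (h i))
  zipWith-tabulate {k = zero}  f g h = refl
  zipWith-tabulate {k = suc k} f g h = cong (f (g zero) (h zero) ∷_) (zipWith-tabulate f (λ i → g (suc i)) (λ i → h (suc i)))

  δ-+ : ∀ {k} (i j : Fin k) c d → δ i j c + δ i j d ≡ δ i j (c + d)
  δ-+ zero    zero    c d = refl
  δ-+ zero    (suc j) c d = +-identityˡ 0#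
  δ-+ (suc i) zero    c d = +-identityˡ 0#
  δ-+ (suc i) (suc j) c d = δ-+ i j c d

  scalar-+ : ∀ c d → scalar c +M scalar d ≡ scalar (c + d)
  scalar-+ c d = trans (zipWith-tabulate _ _ _) (tabulate-cong λ i →
    trans (zipWith-tabulate _ _ _) (tabulate-cong λ j → δ-+ i j c d))

  δ-* : ∀ {k} (i j : Fin k) c d → sumF (tabulate λ l → δ i l c * δ l j d) ≡ δ i j (c * d)
  δ-* {suc k} zero zero c d =
    trans (cong (c * d +_) (sum-zero {k} (λ l → δ zero (suc l) c * δ (suc l) zero d) (λ l → zeroˡ _))) (+-identityʳ _)
  δ-* {suc k} zero (suc j) c d =
    trans (cong₂ _+_ (zeroʳ c) (sum-zero {k} (λ l → δ zero (suc l) c * δ (suc l) (suc j) d) (λ l → zeroˡ _))) (+-identityˡ 0#)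
  δ-* {suc k} (suc i) zero c d =
    trans (cong₂ _+_ (zeroˡ d) (sum-zero {k} (λ l → δ (suc i) (suc l) c * δ (suc l) zero d) (λ l → zeroʳ _))) (+-identityˡ 0#)
  δ-* {suc k} (suc i) (suc j) c d =
    trans (cong₂ _+_ (zeroˡ 0#) (δ-* i j c d)) (+-identityˡ _)

  entry : ∀ {k} c (i j : Fin k) → lookup (lookup (scalarOf k c) i) j ≡ δ i j c
  entry c i j = trans (cong (λ row → lookup row j) (lookup∘tabulate _ i)) (lookup∘tabulate _ j)

  scalar-* : ∀ c d → scalar c ×M scalar d ≡ scalar (c * d)
  scalar-* c d = tabulate-cong λ i → tabulate-cong λ j →
    trans (cong sumF (tabulate-cong λ l → cong₂ _*_ (entry c i l) (entry d l j))) (δ-* i j c d)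

module TermValues (F : Field) (n : ℕ) (S : List (MatrixAlgebra.Op F n)) where
  open import Data.Nat using (_+_; _*_; _^_; _≤_; _<_)
  open import Data.Nat.Properties using (<⇒≤)
  open import Data.Fin using (Fin)
  open import Data.List using (List; []; _∷_; _++_)
  open import Data.List.Relation.Unary.All using (All; []; _∷_)
  import Data.List.Relation.Unary.All as All
  open import Data.List.Relation.Unary.All.Properties using (++⁻ˡ; ++⁻ʳ)
  open import Data.Unit using (⊤; tt)
  open import Data.Empty using (⊥)
  open import Data.Product using (Σ; Σ-syntax; _×_; _,_; proj₁; proj₂)
  open import Relation.Binary.PropositionalEquality
  open Field F using (0#; _·1)
  open MatrixAlgebra F n
  open AlgebraTheory (MatAlg S)
  open Binary
  open Blocks
  open FieldNumerals F using (·1-+; ·1-*)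
  open ScalarMatrices F n using (scalar; scalar-+; scalar-*)

  testEntry : (ξ : Fin 2) → ℕ → Phy ξ
  testEntry zero i = 0#
  testEntry 𝓜    i = scalar (val (2 ^ i ∷ []) ·1)

  TestArgs : List ℕ → (xs : List (Fin 2)) → All Phy xs → Set
  TestArgs []       []       _        = ⊤
  TestArgs []       (_ ∷ _)  _        = ⊥
  TestArgs (_ ∷ _)  []       _        = ⊥
  TestArgs (i ∷ is) (ξ ∷ xs) (v ∷ vs) = v ≡ testEntry ξ i × TestArgs is xs vs

  testArgs-++ : ∀ xs {ys} is (vs : All Phy (xs ++ ys)) → TestArgs is (xs ++ ys) vs →
    Σ[ is₁ ∈ List ℕ ] Σ[ is₂ ∈ List ℕ ]
      (is ≡ is₁ ++ is₂ × TestArgs is₁ xs (proj₁ (splitAll xs vs)) × TestArgs is₂ ys (proj₂ (splitAll xs vs)))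
  testArgs-++ []       is       vs       args         = [] , is , refl , tt , args
  testArgs-++ (x ∷ xs) []       vs       ()
  testArgs-++ (x ∷ xs) (i ∷ is) (v ∷ vs) (v≡ , args) with testArgs-++ xs is vs args
  ... | is₁ , is₂ , refl , args₁ , args₂ = i ∷ is₁ , is₂ , refl , (v≡ , args₁) , args₂

  -- every orderly term has an argument, since every operation has positive arity
  term-nonempty : ∀ {xs ξ} → OT xs ξ → Σ[ x ∈ Fin 2 ] Σ[ xs′ ∈ List (Fin 2) ] (xs ≡ x ∷ xs′)
  args-nonempty : ∀ {xs d ds} → Args xs (d ∷ ds) → Σ[ x ∈ Fin 2 ] Σ[ xs′ ∈ List (Fin 2) ] (xs ≡ x ∷ xs′)
  term-nonempty (var ξ)            = ξ , [] , refl
  term-nonempty (app (addM , _) as) = args-nonempty as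
  term-nonempty (app (mulM , _) as) = args-nonempty as
  term-nonempty (app (addF , _) as) = args-nonempty as
  term-nonempty (app (mulF , _) as) = args-nonempty as
  term-nonempty (app (detM , _) as) = args-nonempty as
  args-nonempty (_∷_ {ys = ys} t as) with term-nonempty t
  ... | x , xs′ , refl = x , xs′ ++ ys , refl

  BlockMatrix : ℕ → ℕ → Matrix n → Set
  BlockMatrix L U M = Σ[ V ∈ ℕ ] (BlockNumber L U V × M ≡ scalar (V ·1))

  BlockValue : ℕ → ℕ → (ξ : Fin 2) → Phy ξ → Set
  BlockValue L U zero _ = ⊤
  BlockValue L U 𝓜    M = BlockMatrix L U M

  block-matrix-+ : ∀ {L s U M N} → L ≤ s → s ≤ U → BlockMatrix L s M → BlockMatrix s U N → BlockMatrix L U (M +M N)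
  block-matrix-+ L≤s s≤U (V , V-block , refl) (W , W-block , refl) =
    V + W , block-+ L≤s s≤U V-block W-block , trans (scalar-+ _ _) (cong scalar (sym (·1-+ V W)))

  block-matrix-* : ∀ {L s U M N} → L ≤ s → s ≤ U → BlockMatrix L s M → BlockMatrix s U N → BlockMatrix L U (M ×M N)
  block-matrix-* L≤s s≤U (V , V-block , refl) (W , W-block , refl) =
    V * W , block-* L≤s s≤U V-block W-block , trans (scalar-* _ _) (cong scalar (sym (·1-* V W)))

  leftover : ∀ xs₁ xs₂ → All Phy (xs₁ ++ xs₂ ++ []) → All Phy []
  leftover xs₁ xs₂ vs = proj₂ (splitAll xs₂ (proj₂ (splitAll xs₁ vs)))

  close-args : ∀ {ξ₁ ξ₂} {B : Set} (g : All Phy (ξ₁ ∷ ξ₂ ∷ []) → B) {x y} (z : All Phy []) →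
    g (x ∷ y ∷ evalArgs [] z) ≡ g (x ∷ y ∷ [])
  close-args g [] = refl

  -- The main invariant, by induction on orderly terms: a term evaluated at the
  -- test entries of increasing positions in [L, U) is a block matrix of [L, U).
  -- For g(t₁, t₂) with g ∈ {+, ×}, the positions of t₂ start at some s and those
  -- of t₁ lie below s, so the two values are block matrices of [L, s) and [s, U).
  term-value : ∀ {xs ξ} (t : OT xs ξ) {L U is vs} →
    TestArgs is xs vs → IncFrom L is → All (_< U) is → BlockValue L U ξ (eval t vs)

  variable-value : ∀ ξ {L U is vs} → TestArgs is (ξ ∷ []) vs → IncFrom L is → All (_< U) is →
    BlockValue L U ξ (eval (var ξ) vs)
  variable-value zero _ _ _ = tt
  variable-value 𝓜 {is = i ∷ []} {v ∷ []} (v≡ , tt) (L≤i , tt) (i<U ∷ []) =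
    val (2 ^ i ∷ []) , block-single L≤i i<U , v≡

  split-value : ∀ {xs₁ xs₂} (t₁ : OT xs₁ 𝓜) (t₂ : OT xs₂ 𝓜) {L U is} {vs : All Phy (xs₁ ++ xs₂ ++ [])} →
    TestArgs is (xs₁ ++ xs₂ ++ []) vs → IncFrom L is → All (_< U) is →
    Σ[ s ∈ ℕ ] (L ≤ s × s ≤ U × BlockMatrix L s (eval t₁ (proj₁ (splitAll xs₁ vs)))
                              × BlockMatrix s U (eval t₂ (proj₁ (splitAll xs₂ (proj₂ (splitAll xs₁ vs))))))

  term-value (var ξ) args inc bnd = variable-value ξ args inc bnd
  term-value (app (addF , _) _) _ _ _ = tt
  term-value (app (mulF , _) _) _ _ _ = tt
  term-value (app (detM , _) _) _ _ _ = tt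
  term-value (app (addM , _) (_∷_ {xs₁} t₁ (_∷_ {xs₂} t₂ []))) {vs = vs} args inc bnd
    with split-value t₁ t₂ args inc bnd
  ... | s , L≤s , s≤U , B₁ , B₂ =
    subst (BlockMatrix _ _) (sym (close-args (opFun addM) (leftover xs₁ xs₂ vs))) (block-matrix-+ L≤s s≤U B₁ B₂)
  term-value (app (mulM , _) (_∷_ {xs₁} t₁ (_∷_ {xs₂} t₂ []))) {vs = vs} args inc bnd
    with split-value t₁ t₂ args inc bnd
  ... | s , L≤s , s≤U , B₁ , B₂ =
    subst (BlockMatrix _ _) (sym (close-args (opFun mulM) (leftover xs₁ xs₂ vs))) (block-matrix-* L≤s s≤U B₁ B₂)

  split-value {xs₁} t₁ t₂ {is = is} {vs} args inc bnd with term-nonempty t₂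
  ... | x , xs′ , refl with testArgs-++ xs₁ is vs args
  ... | is₁ , is₂₃ , refl , args₁ , args₂₃ with testArgs-++ (x ∷ xs′) is₂₃ (proj₂ (splitAll xs₁ vs)) args₂₃
  ... | []    , _     , _    , ()    , _
  ... | _ ∷ _ , _ ∷ _ , _    , _     , ()
  ... | s ∷ r , []    , refl , args₂ , _ with inc-split is₁ s (r ++ []) inc
  ... | inc₁ , is₁<s , L≤s , inc₂ =
      s , L≤s , <⇒≤ (All.head bnd₂) , term-value t₁ args₁ inc₁ is₁<s
    , term-value t₂ args₂ (inc-++⁻ˡ (s ∷ r) inc₂) (++⁻ˡ (s ∷ r) bnd₂)
    where
    bnd₂ = ++⁻ʳ is₁ bnd

module PairsInFR (𝔄 : Algebra) where
  open import Data.Nat using (zero; _≤_; _<_; s≤s)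
  open import Data.Nat.Properties using (≤-refl; <⇒≤; <-trans; ≤-<-trans; m≤n⇒m<n∨m≡n)
  open import Data.List using ([]; _∷_)
  open import Data.List.Relation.Unary.All using ([]; _∷_)
  open import Data.List.Relation.Unary.Any using (here; there)
  open import Data.List.Relation.Unary.Linked using (Linked; [-]; _∷_)
  open import Data.Product using (Σ-syntax; _×_; _,_; proj₁; proj₂)
  open import Data.Sum using (inj₁; inj₂)
  open import Relation.Binary.PropositionalEquality using (refl; trans)
  open Algebra 𝔄
  open AlgebraTheory 𝔄

  taken-twice : ∀ {e} → InΩ e → ∀ i → Σ[ i₁ ∈ ℕ ] Σ[ i₂ ∈ ℕ ] (i₁ < i₂ × e i₁ ≡ e i × e i₂ ≡ e i)
  taken-twice Ω i =
    let (i₁ , _ , e₁) = Ω i 0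
        (i₂ , i₁<i₂ , e₂) = Ω i (suc i₁)
    in i₁ , i₂ , i₁<i₂ , e₁ , e₂

  pair-rep : ∀ (b : Seq) {i₁ i₂ ξ₁ ξ₂ ξ x₁ x₂} → b i₁ ≡ (ξ₁ , x₁) → b i₂ ≡ (ξ₂ , x₂) →
    (f : OT (ξ₁ ∷ ξ₂ ∷ []) ξ) → RepBy b (i₁ ∷ i₂ ∷ []) (ξ , eval f (x₁ ∷ x₂ ∷ []))
  pair-rep b {i₁} {i₂} {ξ₁} {ξ₂} {ξ} {x₁} {x₂} b₁ b₂ f = ξ , retyped (b i₁) (b i₂) b₁ b₂
    where
    retyped : ∀ u v → u ≡ (ξ₁ , x₁) → v ≡ (ξ₂ , x₂) →
      Σ[ f′ ∈ OT (proj₁ u ∷ proj₁ v ∷ []) ξ ] ((ξ , eval f (x₁ ∷ x₂ ∷ [])) ≡ (ξ , eval f′ (toAll (u ∷ v ∷ []))))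
    retyped _ _ refl refl = f , refl

  -- If e ∈ Ω, the value of a binary term (of sort e 0) at two entries i₁ < i₂ of an
  -- e-sorted sequence a lies in FR^e(a): complete it to a sequence below a by
  -- single entries of a of the required sorts at increasing positions τ 1, τ 2, ….
  pair∈FR : ∀ {e} → InΩ e → ∀ a → Sorted e a → ∀ {i₁ i₂} → i₁ < i₂ →
    ∀ {ξ₁ ξ₂ x₁ x₂} → a i₁ ≡ (ξ₁ , x₁) → a i₂ ≡ (ξ₂ , x₂) →
    (f : OT (ξ₁ ∷ ξ₂ ∷ []) (e 0)) → InFR e a (eval f (x₁ ∷ x₂ ∷ []))
  pair∈FR {e} Ω a a-sorted {i₁} {i₂} i₁<i₂ {x₁ = x₁} {x₂} a₁ a₂ f =
    a′ , (ℓ , reps , linked , cross) , a′-sorted , refl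
    where
    τ : ℕ → ℕ
    τ zero    = i₂
    τ (suc k) = proj₁ (Ω (suc k) (suc (τ k)))

    τ-step : ∀ k → τ k < τ (suc k)
    τ-step k = proj₁ (proj₂ (Ω (suc k) (suc (τ k))))

    τ-mono : ∀ {j k} → j < k → τ j < τ k
    τ-mono {j} {suc k} (s≤s j≤k) with m≤n⇒m<n∨m≡n j≤k
    ... | inj₁ j<k  = <-trans (τ-mono j<k) (τ-step k)
    ... | inj₂ refl = τ-step k

    a′ : Seq
    a′ zero    = e 0 , eval f (x₁ ∷ x₂ ∷ [])
    a′ (suc k) = a (τ (suc k))

    ℓ : ℕ → List ℕ
    ℓ zero    = i₁ ∷ i₂ ∷ []
    ℓ (suc k) = τ (suc k) ∷ []

    reps : ∀ j → RepBy a (ℓ j) (a′ j)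
    reps zero    = pair-rep a a₁ a₂ f
    reps (suc k) = proj₁ (a (τ (suc k))) , var _ , refl

    linked : ∀ j → Linked _<_ (ℓ j)
    linked zero    = i₁<i₂ ∷ [-]
    linked (suc k) = [-]

    below-τ : ∀ j {x} → x ∈ ℓ j → x ≤ τ j
    below-τ zero    (here refl)         = <⇒≤ i₁<i₂
    below-τ zero    (there (here refl)) = ≤-refl
    below-τ (suc k) (here refl)         = ≤-refl

    cross : ∀ j j′ → j < j′ → ∀ {x y} → x ∈ ℓ j → y ∈ ℓ j′ → x < y
    cross j (suc k) j<k x∈ℓj (here refl) = ≤-<-trans (below-τ j x∈ℓj) (τ-mono j<k)

    a′-sorted : Sorted e a′
    a′-sorted zero    = refl
    a′-sorted (suc k) = trans (a-sorted (τ (suc k))) (proj₂ (proj₂ (Ω (suc k) (suc (τ k)))))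

module Refutation (F : Field) (charZero : CharZero F) (m : ℕ)
  (S : List (MatrixAlgebra.Op F (suc m)))
  (addM∈S : MatrixAlgebra.addM ∈ S) (mulM∈S : MatrixAlgebra.mulM ∈ S) (detM∈S : MatrixAlgebra.detM ∈ S)
  (e : ℕ → Data.Fin.Fin 2) (e0 : e 0 ≡ zero) where

  open import Data.Nat using (_+_; _*_; _≤_; _<_; z≤n; s≤s)
  open import Data.Nat.Properties using (≤-refl; ≤-trans; m≤m+n; m≤n+m)
  open import Data.List using ([]; _∷_; map)
  open import Data.Nat.ListAction using (sum)
  open import Data.List.Relation.Unary.All using (All; []; _∷_)
  import Data.List.Relation.Unary.All as All
  open import Data.List.Relation.Unary.Any using (here)
  open import Data.List.Relation.Unary.Linked using (Linked; [-]; _∷_)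
  open import Data.Product using (Σ-syntax; _×_; _,_; proj₁)
  open import Data.Sum using ([_,_])
  open import Data.Unit using (tt)
  open import Data.Empty using (⊥-elim)
  open import Relation.Binary.PropositionalEquality using (refl; sym; trans; cong; subst)

  n = suc m
  open Field F using (Carrier; _·1)
  open MatrixAlgebra F n
  open AlgebraTheory (MatAlg S)
  open Binary
  open Blocks
  open FieldNumerals F using (pow; ·1-+; ·1-*; pow-·1-injective)
  open ScalarMatrices F n using (scalar; scalar-+; scalar-*; det-scalar)
  open TermValues F n S
  open PairsInFR (MatAlg S)

  b : Seq
  b i = e i , testEntry (e i) i

  b-sorted : Sorted e b
  b-sorted i = refl

  b-testArgs : ∀ ℓ → TestArgs ℓ (map proj₁ (map b ℓ)) (toAll (map b ℓ))
  b-testArgs []      = tt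
  b-testArgs (i ∷ ℓ) = refl , b-testArgs ℓ

  no-nullary-rep : ∀ {x} → ¬ RepBy b [] x
  no-nullary-rep (_ , f , _) with term-nonempty f
  ... | _ , _ , ()

  entry-block : ∀ {x ℓ L U} → RepBy b ℓ x → proj₁ x ≡ 𝓜 → IncFrom L ℓ → All (_< U) ℓ →
    Σ[ M ∈ Matrix n ] (x ≡ (𝓜 , M) × BlockMatrix L U M)
  entry-block {ℓ = ℓ} (_ , f , refl) refl inc bnd = _ , refl , term-value f (b-testArgs ℓ) inc bnd

  linked⇒inc : ∀ {L x xs} → L ≤ x → Linked _<_ (x ∷ xs) → IncFrom L (x ∷ xs)
  linked⇒inc L≤x [-]          = L≤x , tt
  linked⇒inc L≤x (x<y ∷ link) = L≤x , linked⇒inc x<y link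

  below-sum : ∀ ℓ → All (_< suc (sum ℓ)) ℓ
  below-sum []      = []
  below-sum (x ∷ ℓ) =
    s≤s (m≤m+n x (sum ℓ)) ∷ All.map (λ x<1+Σ → ≤-trans x<1+Σ (s≤s (m≤n+m (sum ℓ) x))) (below-sum ℓ)

  -- matrices represented on consecutive position lists ℓ₁ < ℓ₂ are block matrices of
  -- adjacent blocks [0, s) and [s, U), where s is the first position of ℓ₂
  adjacent-blocks : ∀ {x₁ x₂} ℓ₁ ℓ₂ → RepBy b ℓ₁ x₁ → RepBy b ℓ₂ x₂ → proj₁ x₁ ≡ 𝓜 → proj₁ x₂ ≡ 𝓜 →
    Linked _<_ ℓ₁ → Linked _<_ ℓ₂ → (∀ {x y} → x ∈ ℓ₁ → y ∈ ℓ₂ → x < y) →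
    Σ[ s ∈ ℕ ] Σ[ U ∈ ℕ ] Σ[ M ∈ Matrix n ] Σ[ N ∈ Matrix n ]
      (x₁ ≡ (𝓜 , M) × x₂ ≡ (𝓜 , N) × BlockMatrix 0 s M × BlockMatrix s U N)
  adjacent-blocks []       _       rep₁ _    _ _ _ _ _ = ⊥-elim (no-nullary-rep rep₁)
  adjacent-blocks (_ ∷ _)  []      _    rep₂ _ _ _ _ _ = ⊥-elim (no-nullary-rep rep₂)
  adjacent-blocks (c ∷ cs) (s ∷ r) rep₁ rep₂ sort₁ sort₂ link₁ link₂ ℓ₁<ℓ₂ =
    let (M , x₁≡ , M-block) = entry-block rep₁ sort₁ (linked⇒inc z≤n link₁)
                                (All.tabulate (λ x∈ℓ₁ → ℓ₁<ℓ₂ x∈ℓ₁ (here refl)))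
        (N , x₂≡ , N-block) = entry-block rep₂ sort₂ (linked⇒inc ≤-refl link₂) (below-sum (s ∷ r))
    in s , _ , M , N , x₁≡ , x₂≡ , M-block , N-block

  Coloured : Carrier → Set
  Coloured v = Σ[ V ∈ ℕ ] (Split V × v ≡ pow n (V ·1))

  sum-coloured : ∀ {L s U M N} → BlockMatrix L s M → BlockMatrix s U N → Coloured (det n (M +M N))
  sum-coloured (V , V-block , refl) (W , W-block , refl) =
    V + W , block-+-split V-block W-block ,
    trans (cong (det n) (trans (scalar-+ _ _) (cong scalar (sym (·1-+ V W))))) (det-scalar n _)

  -- V ↦ (V·1)^n is injective in characteristic 0, so a coloured det(M × N) would make V·W split
  product-uncoloured : ∀ {L s U M N} → BlockMatrix L s M → BlockMatrix s U N → ¬ Coloured (det n (M ×M N))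
  product-uncoloured (V , V-block , refl) (W , W-block , refl) (X , X-split , det≡) =
    block-*-notSplit V-block W-block
      (subst Split (pow-·1-injective charZero m X (V * W) (trans (sym det≡) det-product)) X-split)
    where
    det-product : det n (scalar (V ·1) ×M scalar (W ·1)) ≡ pow n ((V * W) ·1)
    det-product = trans (cong (det n) (trans (scalar-* _ _) (cong scalar (sym (·1-* V W))))) (det-scalar n _)

  detSum detProduct : OT (𝓜 ∷ 𝓜 ∷ []) zero
  detSum     = app (detM , detM∈S) (app (addM , addM∈S) (var 𝓜 ∷ var 𝓜 ∷ []) ∷ [])
  detProduct = app (detM , detM∈S) (app (mulM , mulM∈S) (var 𝓜 ∷ var 𝓜 ∷ []) ∷ [])

  Colour : Phy (e 0) → Set
  Colour x = Coloured (subst Phy e0 x)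

  at-e0 : ∀ {xs} → OT xs zero → OT xs (e 0)
  at-e0 = subst (OT _) (sym e0)

  retract : ∀ {ξ xs} (q : ξ ≡ zero) (f : OT xs zero) vs → subst Phy q (eval (subst (OT xs) (sym q) f) vs) ≡ eval f vs
  retract refl f vs = refl

  -- Given a ≤ b, pick matrix positions i₁ < i₂; then det(a i₁ + a i₂) and
  -- det(a i₁ × a i₂) both lie in FR(a) but only the first is coloured.
  not-Ramsey : InΩ e → ∀ {i} → e i ≡ 𝓜 → ¬ IsRamsey e
  not-Ramsey Ω {i} eᵢ≡𝓜 ramsey with taken-twice Ω i | ramsey b b-sorted Colour
  ... | i₁ , i₂ , i₁<i₂ , e₁ , e₂ | a , a-sorted , (ℓ , reps , linked , cross) , monochromatic
    with adjacent-blocks (ℓ i₁) (ℓ i₂) (reps i₁) (reps i₂)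
           (trans (a-sorted i₁) (trans e₁ eᵢ≡𝓜)) (trans (a-sorted i₂) (trans e₂ eᵢ≡𝓜))
           (linked i₁) (linked i₂) (cross i₁ i₂ i₁<i₂)
  ... | s , U , M , N , a₁ , a₂ , M-block , N-block =
    [ (λ all-coloured → product-uncoloured M-block N-block
          (subst Coloured (retract e0 detProduct _) (all-coloured _ (in-FR detProduct))))
    , (λ none-coloured → none-coloured _ (in-FR detSum)
          (subst Coloured (sym (retract e0 detSum _)) (sum-coloured M-block N-block)))
    ] monochromatic
    where
    in-FR : (f : OT (𝓜 ∷ 𝓜 ∷ []) zero) → InFR e a (eval (at-e0 f) (M ∷ N ∷ []))
    in-FR f = pair∈FR Ω a a-sorted i₁<i₂ a₁ a₂ (at-e0 f)

matrix-sort : (ξ : Data.Fin.Fin 2) → ¬ ξ ≡ zero → ξ ≡ 𝓜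
matrix-sort zero ξ≢0 = ⊥-elim (ξ≢0 refl)
matrix-sort 𝓜    _   = refl

required-ops : ∀ (F : Field) n {S : List (MatrixAlgebra.Op F n)} → S ∈ MatrixAlgebra.families F n →
  MatrixAlgebra.addM ∈ S × MatrixAlgebra.mulM ∈ S × MatrixAlgebra.detM ∈ S
required-ops F n (here refl)                         = here refl , there (here refl) , there (there (here refl))
required-ops F n (there (here refl))                 = here refl , there (here refl) , there (there (there (here refl)))
required-ops F n (there (there (here refl)))         = here refl , there (here refl) , there (there (there (here refl)))
required-ops F n (there (there (there (here refl)))) = here refl , there (here refl) , there (there (there (there (here refl))))

mainTheorem10 : (F : Field) → CharZero F → Infinite (Field.Carrier F) →
    (m : ℕ) → let n = suc m in
    (S : List (MatrixAlgebra.Op F n)) → S ∈ MatrixAlgebra.families F n →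
    (e : ℕ → Data.Fin.Fin 2) →
    AlgebraTheory.InΩ (MatrixAlgebra.MatAlg F n S) e → e 0 ≡ zero →
    AlgebraTheory.Nonconstant (MatrixAlgebra.MatAlg F n S) e →
    ¬ AlgebraTheory.IsRamsey (MatrixAlgebra.MatAlg F n S) e
mainTheorem10 F charZero _ m S S∈families e Ω e0 (i , eᵢ≢e0) =
  let (addM∈S , mulM∈S , detM∈S) = required-ops F (suc m) S∈families
  in Refutation.not-Ramsey F charZero m S addM∈S mulM∈S detM∈S e e0 Ω
       (matrix-sort (e i) (λ eᵢ≡0 → eᵢ≢e0 (trans eᵢ≡0 (sym e0))))
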